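{- For every dual-normal program $P$, the set $\mathrm{UE}(P)$ of UE-models of $P$ is UE-complete and splittable.
   Context: A rule $r$ is an expression $a_1\vee\cdots\vee a_l\leftarrow a_{l+1},\ldots,a_m,\mathit{not}\ a_{m+1},\ldots,\mathit{not}\ a_n$ with propositional atoms; $H(r)$ head atoms, $B^+(r)$, $B^-(r)$ positive/negative body atoms; a constraint has $H(r)=\emptyset$. A program is a finite set of rules. A set $I$ of atoms satisfies $r$ if $(H(r)\cup B^-(r))\cap I\neq\emptyset$ or $B^+(r)\setminus I\neq\emptyset$; a model satisfies all rules. Reduct: $P^I=\{H(r)\leftarrow B^+(r)\mid r\in P, I\cap B^-(r)=\emptyset\}$. $P$ is dual-normal if every rule is a constraint or has $|B^+(r)|\le1$. An SE-interpretation is a pair $(X,Y)$ with $X\subseteq Y$; it is an SE-model of $P$ if $Y$ is a model of $P$ and $X$ a model of $P^Y$. An SE-model $(X,Y)$ is a UE-model of $P$ if for every SE-model $(X',Y)$ of $P$ with $X\subset X'$ we have $X'=Y$; $\mathrm{UE}(P)$ is the set of UE-models. A set $\mathcal{S}$ of SE-interpretations is UE-complete if (1) $(X,Y)\in\mathcal{S}$ implies $(Y,Y)\in\mathcal{S}$; (2) $(X,Y),(Z,Z)\in\mathcal{S}$ and $Y\subset Z$ imply there is $Y'$ with $Y\subseteq Y'\subset Z$ and $(Y',Z)\in\mathcal{S}$; (3) $(X,Y),(X',Y)\in\mathcal{S}$ and $X\subset X'$ imply $X'=Y$. $\mathcal{S}$ is splittable if for every $Z$ with $(Z,Z)\in\mathcal{S}$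 and every $(X_1,Y_1),\ldots,(X_k,Y_k)\in\mathcal{S}$ with all $Y_i\subseteq Z$, either $(X_1\cup\cdots\cup X_k,Z)\in\mathcal{S}$ or $(Z',Z)\in\mathcal{S}$ for some $Z'$ with $X_1\cup\cdots\cup X_k\subseteq Z'\subset Z$. -}

module Defs where

open import Data.Nat using (ℕ; _≤_)
open import Data.Fin.Subset using (Subset; _⊆_; _⊂_; _∩_; _∪_; _─_; ⊥; ⋃; Nonempty; ∣_∣)
open import Data.Fin.Subset.Properties using (nonempty?)
open import Data.List using (List; []; _∷_)
open import Data.List.NonEmpty using (List⁺; toList)
import Data.List as L
open import Data.List.Relation.Unary.All using (All)
open import Data.List.Membership.Propositional using (_∈_)
open import Data.Product using (_×_; _,_; ∃; proj₁; proj₂)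
open import Data.Sum using (_⊎_)
open import Relation.Nullary using (yes; no)
open import Relation.Binary.PropositionalEquality using (_≡_)

-- Atoms are drawn from a finite universe Fin n; interpretations are Subset n.

-- A rule  H ← B⁺, not B⁻  (head is a disjunction of atoms; head = ⊥ means constraint).
record Rule (n : ℕ) : Set where
  constructor rule
  field
    head    : Subset n
    posBody : Subset n
    negBody : Subset n
open Rule public

Program : ℕ → Set
Program n = List (Rule n)

IsConstraint : ∀ {n} → Rule n → Set
IsConstraint r = head r ≡ ⊥

Satisfies : ∀ {n} → Subset n → Rule n → Set
Satisfies I r = Nonempty ((head r ∪ negBody r) ∩ I) ⊎ Nonempty (posBody r ─ I)

IsModel : ∀ {n} → Subset n → Program n → Set
IsModel I P = All (Satisfies I) P

reduct : ∀ {n} → Program n → Subset n → Program n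
reduct [] I = []
reduct (r ∷ P) I with nonempty? (I ∩ negBody r)
... | yes _ = reduct P I
... | no  _ = rule (head r) (posBody r) ⊥ ∷ reduct P I

DualNormal : ∀ {n} → Program n → Set
DualNormal P = ∀ r → r ∈ P → IsConstraint r ⊎ ∣ posBody r ∣ ≤ 1

-- SE-interpretations (X , Y) with X ⊆ Y; sets of them are predicates.
SEInterp : ℕ → Set
SEInterp n = Subset n × Subset n

SESet : ℕ → Set₁
SESet n = Subset n → Subset n → Set

IsSEModel : ∀ {n} → Program n → Subset n → Subset n → Set
IsSEModel P X Y = X ⊆ Y × IsModel Y P × IsModel X (reduct P Y)

IsUEModel : ∀ {n} → Program n → Subset n → Subset n → Set
IsUEModel P X Y =
  IsSEModel P X Y × (∀ X' → IsSEModel P X' Y → X ⊂ X' → X' ≡ Y)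

UE : ∀ {n} → Program n → SESet n
UE P X Y = IsUEModel P X Y

UEComplete : ∀ {n} → SESet n → Set
UEComplete S =
  (∀ X Y → S X Y → S Y Y)
  × (∀ X Y Z → S X Y → S Z Z → Y ⊂ Z → ∃ λ Y' → Y ⊆ Y' × Y' ⊂ Z × S Y' Z)
  × (∀ X X' Y → S X Y → S X' Y → X ⊂ X' → X' ≡ Y)

Splittable : ∀ {n} → SESet n → Set
Splittable S =
  ∀ Z → S Z Z → (fam : List⁺ (SEInterp _)) →
  All (λ p → S (proj₁ p) (proj₂ p) × proj₂ p ⊆ Z) (toList fam) →
  let U = ⋃ (L.map proj₁ (toList fam)) in
  S U Z ⊎ (∃ λ Z' → U ⊆ Z' × Z' ⊂ Z × S Z' Z)

module Submission where

-- Write ReductModel P Z X for "X is a model of the reduct P^Z", stated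
-- rule by rule on P.  Two observations drive everything:
--  * maximality: the powerset of a finite atom set is ⊃-well-founded, so every SE-model
--    (X , Z) with X ⊂ Z lies below a ⊂-maximal one, i.e. below a UE-model (X' , Z)
--    with X' ⊂ Z; this gives condition (2) of UE-completeness and the second
--    alternative of splittability, while (1) and (3) are immediate from the definitions;
--  * union closure: a positive rule h ← b with |b| ≤ 1 has models closed under
--    nonempty unions, and a constraint satisfied by Z is satisfied (in the reduct) by
--    every subset of Z.  Hence for a dual-normal P the union of the Xᵢ of SE-models
--    (Xᵢ , Yᵢ) with Yᵢ ⊆ Z is again an SE-model (⋃ Xᵢ , Z); it is then either
--    itself a UE-model (when ⋃ Xᵢ = Z) or lies below one by maximality.

open import Defs
open import Data.Nat using (ℕ; _≤_; s≤s; z≤n)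
open import Data.Nat.Properties using (≤-trans)
open import Data.Product using (_×_; _,_; ∃; proj₁; proj₂)
open import Data.Sum using (_⊎_; inj₁; inj₂)
open import Data.Empty using (⊥-elim)
open import Data.Fin.Subset
  using (Subset; _∈_; _∉_; _⊆_; _⊂_; _⊃_; _∩_; _∪_; _─_; ⊥; ⋃; Nonempty; ∣_∣; inside; outside)
open import Data.Fin.Subset.Properties
  using (nonempty?; _∈?_; _⊆?_; _⊂?_; anySubset?; ⊆-refl; ⊆-trans; ⊆-antisym;
         x∈p∩q⁺; x∈p∩q⁻; x∈p∪q⁺; x∈p∪q⁻; ∉⊥; x∈p∧x∉q⇒x∈p─q; p─q⊆p; ∣p∣≤∣x∷p∣;
         p⊆p∪q; q⊆p∪q)
open import Data.Fin.Subset.Induction using (Acc; acc; ⊃-wellFounded)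
open import Data.List using (List; []; _∷_)
open import Data.List.NonEmpty using (_∷_)
open import Data.List.Relation.Unary.All as All using (All; []; _∷_; all?)
open import Data.List.Relation.Unary.All.Properties using (map⁺)
open import Data.List.Relation.Unary.Any using (here; there)
open import Data.List.Membership.Propositional using () renaming (_∈_ to _∈ₗ_)
open import Data.Vec using (_∷_; here; there)
open import Relation.Nullary using (¬_; Dec; yes; no)
open import Relation.Nullary.Decidable using (_×-dec_; _⊎-dec_)
open import Relation.Unary using (Decidable)
open import Relation.Binary.PropositionalEquality using (_≡_; refl; sym; subst; cong)
open import Data.Fin using (Fin; zero; suc)

private
  variable
    n : ℕ
    h b X Y Z : Subset n

x∈p─q⇒x∉q : (p q : Subset n) {x : Fin n} → x ∈ p ─ q → x ∉ q
x∈p─q⇒x∉q (s ∷ p) (inside  ∷ q) {zero} ()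
x∈p─q⇒x∉q (s ∷ p) (outside ∷ q) {zero} _ ()
x∈p─q⇒x∉q (s ∷ p) (t ∷ q) {suc x} (there x∈p─q) (there x∈q) = x∈p─q⇒x∉q p q x∈p─q x∈q

x∈p⇒1≤∣p∣ : {p : Subset n} {x : Fin n} → x ∈ p → 1 ≤ ∣ p ∣
x∈p⇒1≤∣p∣ here = s≤s z≤n
x∈p⇒1≤∣p∣ {p = s ∷ p} (there x∈p) = ≤-trans (x∈p⇒1≤∣p∣ x∈p) (∣p∣≤∣x∷p∣ s p)

∣p∣≤1⇒unique : (p : Subset n) {x y : Fin n} → ∣ p ∣ ≤ 1 → x ∈ p → y ∈ p → x ≡ y
∣p∣≤1⇒unique (inside ∷ p) _ here here = refl
∣p∣≤1⇒unique (inside ∷ p) (s≤s p≤0) here (there y∈p) with ≤-trans (x∈p⇒1≤∣p∣ y∈p) p≤0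
... | ()
∣p∣≤1⇒unique (inside ∷ p) (s≤s p≤0) (there x∈p) _ with ≤-trans (x∈p⇒1≤∣p∣ x∈p) p≤0
... | ()
∣p∣≤1⇒unique (outside ∷ p) p≤1 (there x∈p) (there y∈p) =
  cong suc (∣p∣≤1⇒unique p p≤1 x∈p y∈p)

⊆∧⊄⇒≡ : {p q : Subset n} → p ⊆ q → ¬ (p ⊂ q) → p ≡ q
⊆∧⊄⇒≡ {p = p} p⊆q p⊄q = ⊆-antisym p⊆q q⊆p
  where
  q⊆p : ∀ {x} → x ∈ _ → x ∈ p
  q⊆p {x} x∈q with x ∈? p
  ... | yes x∈p = x∈p
  ... | no  x∉p = ⊥-elim (p⊄q (p⊆q , x , x∈q , x∉p))

⋃⁻ : (Xs : List (Subset n)) {x : Fin n} → x ∈ ⋃ Xs → ∃ λ X → X ∈ₗ Xs × x ∈ X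
⋃⁻ [] x∈⊥ = ⊥-elim (∉⊥ x∈⊥)
⋃⁻ (X ∷ Xs) x∈⋃ with x∈p∪q⁻ X (⋃ Xs) x∈⋃
... | inj₁ x∈X  = X , here refl , x∈X
... | inj₂ x∈Xs = let (X' , X'∈ , x∈X') = ⋃⁻ Xs x∈Xs in X' , there X'∈ , x∈X'

⋃⁺ : {Xs : List (Subset n)} → X ∈ₗ Xs → X ⊆ ⋃ Xs
⋃⁺ {Xs = X ∷ Xs} (here refl) = p⊆p∪q (⋃ Xs)
⋃⁺ {Xs = X' ∷ Xs} (there X∈) = ⊆-trans (⋃⁺ X∈) (q⊆p∪q X' (⋃ Xs))

⋃-least : {Xs : List (Subset n)} → All (_⊆ Z) Xs → ⋃ Xs ⊆ Z
⋃-least {Xs = Xs} below x∈⋃ =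
  let (X , X∈ , x∈X) = ⋃⁻ Xs x∈⋃ in All.lookup below X∈ x∈X

-- X satisfies the positive rule h ← b; every rule of a reduct has this shape.
PosSat : Subset n → Subset n → Subset n → Set
PosSat X h b = Nonempty (h ∩ X) ⊎ Nonempty (b ─ X)

sat⇒posSat : Satisfies X (rule h b ⊥) → PosSat X h b
sat⇒posSat {X = X} {h = h} (inj₁ (x , x∈)) with x∈p∩q⁻ (h ∪ ⊥) X x∈
... | x∈h∪⊥ , x∈X with x∈p∪q⁻ h ⊥ x∈h∪⊥
...   | inj₁ x∈h = inj₁ (x , x∈p∩q⁺ (x∈h , x∈X))
...   | inj₂ x∈⊥ = ⊥-elim (∉⊥ x∈⊥)
sat⇒posSat (inj₂ body) = inj₂ body

posSat⇒sat : PosSat X h b → Satisfies X (rule h b ⊥)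
posSat⇒sat {X = X} {h = h} (inj₁ (x , x∈)) =
  let (x∈h , x∈X) = x∈p∩q⁻ h X x∈ in inj₁ (x , x∈p∩q⁺ (x∈p∪q⁺ (inj₁ x∈h) , x∈X))
posSat⇒sat (inj₂ body) = inj₂ body

-- X is a model of the reduct P^Y, read off rule by rule on P: every rule whose
-- negative body avoids Y is satisfied by X as a positive rule.
ReductModel : Program n → Subset n → Subset n → Set
ReductModel P Y X =
  ∀ {r} → r ∈ₗ P → ¬ Nonempty (Y ∩ negBody r) → PosSat X (head r) (posBody r)

reductModel⁻ : (P : Program n) (Y : Subset n) → IsModel X (reduct P Y) → ReductModel P Y X
reductModel⁻ (r ∷ P) Y m r'∈ avoids with nonempty? (Y ∩ negBody r)
reductModel⁻ (r ∷ P) Y m (here refl) avoids | yes meets = ⊥-elim (avoids meets)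
reductModel⁻ (r ∷ P) Y m (there r'∈) avoids | yes _ = reductModel⁻ P Y m r'∈ avoids
reductModel⁻ (r ∷ P) Y m (here refl) _ | no _ = sat⇒posSat (All.head m)
reductModel⁻ (r ∷ P) Y m (there r'∈) avoids | no _ = reductModel⁻ P Y (All.tail m) r'∈ avoids

reductModel⁺ : (P : Program n) (Y : Subset n) → ReductModel P Y X → IsModel X (reduct P Y)
reductModel⁺ [] Y _ = []
reductModel⁺ (r ∷ P) Y sat with nonempty? (Y ∩ negBody r)
... | yes _ = reductModel⁺ P Y (λ r'∈ → sat (there r'∈))
... | no avoids = posSat⇒sat (sat (here refl) avoids) ∷ reductModel⁺ P Y (λ r'∈ → sat (there r'∈))

model⇒reductModel : {P : Program n} → IsModel X P → X ⊆ Y → ReductModel P Y X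
model⇒reductModel {X = X} {P = P} modX X⊆Y {r} r∈ avoids with All.lookup modX r∈
... | inj₂ body = inj₂ body
... | inj₁ (x , x∈) with x∈p∩q⁻ (head r ∪ negBody r) X x∈
...   | x∈h∪n , x∈X with x∈p∪q⁻ (head r) (negBody r) x∈h∪n
...     | inj₁ x∈h = inj₁ (x , x∈p∩q⁺ (x∈h , x∈X))
...     | inj₂ x∈n = ⊥-elim (avoids (x , x∈p∩q⁺ (X⊆Y x∈X , x∈n)))

-- Enlarging Y removes rules from the reduct, so its models only grow.
reductModel-antitone : {P : Program n} → Y ⊆ Z → ReductModel P Y X → ReductModel P Z X
reductModel-antitone {Y = Y} Y⊆Z sat r∈ avoidsZ = sat r∈ λ (x , x∈) →
  let (x∈Y , x∈n) = x∈p∩q⁻ Y _ x∈ in avoidsZ (x , x∈p∩q⁺ (Y⊆Z x∈Y , x∈n))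

constraint-downward : (r : Rule n) → IsConstraint r → Satisfies Z r →
  ¬ Nonempty (Z ∩ negBody r) → X ⊆ Z → PosSat X (head r) (posBody r)
constraint-downward {Z = Z} r isC (inj₁ (x , x∈)) avoids _ with x∈p∩q⁻ (head r ∪ negBody r) Z x∈
... | x∈h∪n , x∈Z with x∈p∪q⁻ (head r) (negBody r) x∈h∪n
...   | inj₁ x∈h = ⊥-elim (∉⊥ (subst (x ∈_) isC x∈h))
...   | inj₂ x∈n = ⊥-elim (avoids (x , x∈p∩q⁺ (x∈Z , x∈n)))
constraint-downward {Z = Z} r _ (inj₂ (x , x∈b─Z)) _ X⊆Z =
  inj₂ (x , x∈p∧x∉q⇒x∈p─q (p─q⊆p (posBody r) Z x∈b─Z)
                          (λ x∈X → x∈p─q⇒x∉q (posBody r) Z x∈b─Z (X⊆Z x∈X)))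

posSat-member : {Xs : List (Subset n)} → X ∈ₗ Xs → PosSat X h b → ¬ Nonempty (b ─ X) →
  PosSat (⋃ Xs) h b
posSat-member {h = h} X∈ (inj₁ (x , x∈)) _ =
  let (x∈h , x∈X) = x∈p∩q⁻ h _ x∈ in inj₁ (x , x∈p∩q⁺ (x∈h , ⋃⁺ X∈ x∈X))
posSat-member _ (inj₂ body) ¬body = ⊥-elim (¬body body)

-- Models of a positive rule with at most one body atom are closed under nonempty unions:
-- if the body atom a is missing from the union we are done, otherwise a lies in some
-- member, whose body condition then fails.
posSat-⋃ : ∣ b ∣ ≤ 1 → (X₀ : Subset n) (Xs : List (Subset n)) →
  All (λ X → PosSat X h b) (X₀ ∷ Xs) → PosSat (⋃ (X₀ ∷ Xs)) h b
posSat-⋃ {b = b} b≤1 X₀ Xs sats with nonempty? b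
... | no b-empty =
  posSat-member {Xs = X₀ ∷ Xs} (here refl) (All.head sats) λ (x , x∈) → b-empty (x , p─q⊆p b X₀ x∈)
... | yes (a , a∈b) with a ∈? ⋃ (X₀ ∷ Xs)
...   | no a∉⋃ = inj₂ (a , x∈p∧x∉q⇒x∈p─q a∈b a∉⋃)
...   | yes a∈⋃ with ⋃⁻ (X₀ ∷ Xs) a∈⋃
...     | X , X∈ , a∈X = posSat-member X∈ (All.lookup sats X∈) λ (c , c∈b─X) →
  x∈p─q⇒x∉q b X c∈b─X (subst (_∈ X) (∣p∣≤1⇒unique b b≤1 a∈b (p─q⊆p b X c∈b─X)) a∈X)

se-⋃ : {P : Program n} → DualNormal P → IsModel Z P → (X₀ : Subset n) (Xs : List (Subset n)) →
  All (λ X → X ⊆ Z × ReductModel P Z X) (X₀ ∷ Xs) → IsSEModel P (⋃ (X₀ ∷ Xs)) Z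
se-⋃ {Z = Z} {P = P} dn modZ X₀ Xs members =
  ⋃⊆Z , modZ , reductModel⁺ P Z sat
  where
  ⋃⊆Z : ⋃ (X₀ ∷ Xs) ⊆ Z
  ⋃⊆Z = ⋃-least (All.map proj₁ members)
  sat : ReductModel P Z (⋃ (X₀ ∷ Xs))
  sat {r} r∈ avoids with dn r r∈
  ... | inj₁ isC = constraint-downward r isC (All.lookup modZ r∈) avoids ⋃⊆Z
  ... | inj₂ b≤1 = posSat-⋃ b≤1 X₀ Xs (All.map (λ m → proj₂ m r∈ avoids) members)

-- On the finite powerset every member of a decidable family lies below a ⊂-maximal
-- member; the search climbs strictly upward, which terminates since _⊃_ is well founded.
maximal-above : ∀ {ℓ} {Q : Subset n → Set ℓ} → Decidable Q → ∀ X → Q X →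
  ∃ λ M → X ⊆ M × Q M × (∀ W → Q W → ¬ M ⊂ W)
maximal-above {Q = Q} Q? X qX = climb X (⊃-wellFounded X) qX
  where
  climb : ∀ X → Acc _⊃_ X → Q X → ∃ λ M → X ⊆ M × Q M × (∀ W → Q W → ¬ M ⊂ W)
  climb X (acc above) qX with anySubset? (λ W → Q? W ×-dec (X ⊂? W))
  ... | no none = X , ⊆-refl , qX , λ W qW X⊂W → none (W , qW , X⊂W)
  ... | yes (W , qW , X⊂W) =
    let (M , W⊆M , qM , maxM) = climb W (above X⊂W) qW in
    M , ⊆-trans (proj₁ X⊂W) W⊆M , qM , maxM

isSEModel? : (P : Program n) (X Y : Subset n) → Dec (IsSEModel P X Y)
isSEModel? P X Y = (X ⊆? Y) ×-dec (all? (satisfies? Y) P ×-dec all? (satisfies? X) (reduct P Y))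
  where
  satisfies? : (I : Subset n) (r : Rule n) → Dec (Satisfies I r)
  satisfies? I r = nonempty? _ ⊎-dec nonempty? _

total-ue : {P : Program n} → IsModel Y P → UE P Y Y
total-ue {P = P} modY =
  (⊆-refl , modY , reductModel⁺ P _ (model⇒reductModel modY ⊆-refl)) ,
  λ X' seX' (_ , x , x∈X' , x∉Y) → ⊥-elim (x∉Y (proj₁ seX' x∈X'))

-- An SE-model (X , Z) with X ⊂ Z lies below a UE-model (X' , Z) with X' ⊂ Z:
-- take X' maximal among the SE-models strictly below Z.
extend-to-ue : {P : Program n} → IsSEModel P X Z → X ⊂ Z →
  ∃ λ X' → X ⊆ X' × X' ⊂ Z × UE P X' Z
extend-to-ue {X = X} {Z = Z} {P = P} seX X⊂Z
  with maximal-above (λ W → isSEModel? P W Z ×-dec (W ⊂? Z)) X (seX , X⊂Z)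
... | M , X⊆M , (seM , M⊂Z) , maxM =
  M , X⊆M , M⊂Z , (seM , λ X' seX' M⊂X' →
    ⊆∧⊄⇒≡ (proj₁ seX') λ X'⊂Z → maxM X' (seX' , X'⊂Z) M⊂X')

ue-or-below : {P : Program n} {U : Subset n} → IsSEModel P U Z →
  UE P U Z ⊎ ∃ λ Z' → U ⊆ Z' × Z' ⊂ Z × UE P Z' Z
ue-or-below {Z = Z} {P = P} {U = U} seU@(U⊆Z , modZ , _) with U ⊂? Z
... | yes U⊂Z = inj₂ (extend-to-ue seU U⊂Z)
... | no  U⊄Z = inj₁ (subst (λ W → UE P W Z) (sym (⊆∧⊄⇒≡ U⊆Z U⊄Z)) (total-ue modZ))

se-below : {P : Program n} → IsSEModel P X Y → Y ⊆ Z → X ⊆ Z × ReductModel P Z X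
se-below {Y = Y} {P = P} (X⊆Y , _ , modX) Y⊆Z =
  ⊆-trans X⊆Y Y⊆Z , reductModel-antitone Y⊆Z (reductModel⁻ P Y modX)

theorem7 : ∀ (n : ℕ) (P : Program n) → DualNormal P →
    UEComplete (UE P) × Splittable (UE P)
theorem7 n P dn = (ue-top , ue-between , ue-antichain) , ue-split
  where
  ue-top : ∀ X Y → UE P X Y → UE P Y Y
  ue-top _ _ ((_ , modY , _) , _) = total-ue modY

  ue-between : ∀ X Y Z → UE P X Y → UE P Z Z → Y ⊂ Z → ∃ λ Y' → Y ⊆ Y' × Y' ⊂ Z × UE P Y' Z
  ue-between _ Y Z ((_ , modY , _) , _) ((_ , modZ , _) , _) Y⊂Z@(Y⊆Z , _) =
    extend-to-ue (Y⊆Z , modZ , reductModel⁺ P Z (model⇒reductModel modY Y⊆Z)) Y⊂Z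

  ue-antichain : ∀ X X' Y → UE P X Y → UE P X' Y → X ⊂ X' → X' ≡ Y
  ue-antichain _ X' _ (_ , maxX) (seX' , _) = maxX X' seX'

  ue-split : Splittable (UE P)
  ue-split Z ((_ , modZ , _) , _) (p₀ ∷ ps) family =
    ue-or-below (se-⋃ dn modZ _ _ (map⁺ (All.map (λ ((seᵢ , _) , Yᵢ⊆Z) → se-below seᵢ Yᵢ⊆Z) family)))
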